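{- For every positive integer $n$, the power series $\dfrac{(q^2;q^2)_n}{(q;q^2)_n^2}$ is positive, i.e., every coefficient of its expansion in powers of $q$ (including the constant term) is strictly positive.
   Context: For a nonnegative integer $n$, $(A;q)_n := \prod_{j=0}^{n-1}(1-Aq^j)$. A power series $\sum_{n\ge0} f_n q^n\in\mathbb{R}[[q]]$ is called positive if $f_n>0$ for every $n\ge 0$. -}

module Defs where

open import Data.Nat using (ℕ; zero; suc; _∸_; _≟_) renaming (_+_ to _+ℕ_; _*_ to _*ℕ_)
open import Data.Integer using (ℤ; _+_; _*_; _-_; 0ℤ; 1ℤ)
open import Relation.Nullary using (yes; no)

-- Formal power series in q with integer coefficients: f m = coefficient of q^m.
PS : Set
PS = ℕ → ℤ

sumTo : ℕ → (ℕ → ℤ) → ℤ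
sumTo zero    g = g 0
sumTo (suc m) g = sumTo m g + g (suc m)

_⊛_ : PS → PS → PS
(f ⊛ g) m = sumTo m (λ k → f k * g (m ∸ k))

infixl 7 _⊛_

mono : ℕ → PS
mono k m with m ≟ k
... | yes _ = 1ℤ
... | no  _ = 0ℤ

one : PS
one = mono 0

-- q-Pochhammer symbol (q^a ; q^d)_n = ∏_{j=0}^{n-1} (1 - q^(a + d j)).
poch : ℕ → ℕ → ℕ → PS
poch a d zero    = one
poch a d (suc n) = poch a d n ⊛ (λ m → one m - mono (a +ℕ d *ℕ n) m)

-- The series is ∏_{k<n} (1 - q^(2k+2)) / (1 - q^(2k+1))².  For odd s = 2a+1, t = 2b+1 with
-- a + b = k the partial fraction
--   (1 - q^(s+t)) / ((1 - q^s)(1 - q^t)) = 1/(1 - q^t) + q^s/(1 - q^s)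
-- absorbs the k-th numerator and leaves a sum of two products of the same shape.  Processing
-- k = 0, 1, … one keeps at most two copies of each 1/(1 - q^(2i+1)), k + 2 of them with i ≤ k
-- at step k, so a pigeonhole count over the pairs (a, k - a) always finds a pair with three
-- copies between them, enough for the identity.  In the end only products of geometric series
-- and monomials remain: every coefficient is ≥ 0 and the constant term is 1.  Choosing a ≠ 0
-- keeps 1/(1 - q) in the unshifted summand, and 1/(1 - q) times such a series is positive.

{-# OPTIONS --safe #-}
module Submission where

open import Defs
open import Data.Nat using (ℕ; _≤_)
open import Data.Integer using (ℤ; _<_; 0ℤ)
open import Relation.Binary.PropositionalEquality using (_≡_)

open import Algebra.Bundles using (CommutativeMonoid)
import Algebra.Properties.CommutativeSemigroup as CommutativeSemigroupProperties
import Algebra.Solver.CommutativeMonoid as CommutativeMonoidSolver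
import Relation.Binary.Reasoning.Setoid
open import Data.Bool.Base using (if_then_else_)
open import Data.Empty using (⊥-elim)
open import Data.Integer.Base as ℤ using (_+_; _*_; _-_; 1ℤ; +_; +≤+; +<+)
import Data.Integer.Properties as ℤ
open import Data.Integer.Tactic.RingSolver using (solve-∀)
open import Data.Nat.Base as ℕ using (zero; suc; _∸_; z≤n; s≤s; NonZero)
open import Data.Nat.Divisibility using (_∣_; _∣?_; _∣0; 1∣_; ∣-refl; >⇒∤; ∣m+n∣m⇒∣n; ∣m∸n∣n⇒∣m)
import Data.Nat.Properties as ℕ
import Data.Nat.Tactic.RingSolver as ℕ-Solver
open import Data.Product using (∃; ∃₂; _×_; _,_; proj₁)
open import Data.Sum using (inj₁; inj₂)
open import Function using (_∘_)
open import Level using (0ℓ)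
open import Relation.Binary.Bundles using (Setoid)
open import Relation.Binary.PropositionalEquality
  using (refl; sym; trans; cong; cong₂; subst; _≢_; ≢-sym; module ≡-Reasoning)
open import Relation.Nullary using (¬_; Dec; yes; no; does)
open import Relation.Nullary.Decidable using (dec-true; dec-false)

-- Finite sums over a commutative monoid

module RangeSum {c ℓ} (M : CommutativeMonoid c ℓ) where

  open CommutativeMonoid M renaming (refl to ≈-refl; sym to ≈-sym; trans to ≈-trans)
  open CommutativeSemigroupProperties commutativeSemigroup using (interchange; x∙yz≈y∙xz)
  open import Relation.Binary.Reasoning.Setoid setoid

  ∑< : ℕ → (ℕ → Carrier) → Carrier
  ∑< zero    F = ε
  ∑< (suc n) F = ∑< n F ∙ F n

  ∑<-cong : ∀ n {F H : ℕ → Carrier} → (∀ i → i ℕ.< n → F i ≈ H i) → ∑< n F ≈ ∑< n H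
  ∑<-cong zero    F≈H = ≈-refl
  ∑<-cong (suc n) F≈H = ∙-cong (∑<-cong n (λ i i<n → F≈H i (ℕ.m<n⇒m<1+n i<n))) (F≈H n (ℕ.n<1+n n))

  ∑<-ε : ∀ n {F : ℕ → Carrier} → (∀ i → i ℕ.< n → F i ≈ ε) → ∑< n F ≈ ε
  ∑<-ε n F≈ε = ≈-trans (∑<-cong n F≈ε) (ε-only n)
    where
    ε-only : ∀ n → ∑< n (λ _ → ε) ≈ ε
    ε-only zero    = ≈-refl
    ε-only (suc n) = ≈-trans (identityʳ _) (ε-only n)

  ∑<-distrib : ∀ n (F H : ℕ → Carrier) → ∑< n (λ i → F i ∙ H i) ≈ ∑< n F ∙ ∑< n H
  ∑<-distrib zero    F H = ≈-sym (identityˡ ε)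
  ∑<-distrib (suc n) F H = ≈-trans (∙-congʳ (∑<-distrib n F H)) (interchange _ _ _ _)

  ∑<-head : ∀ n (F : ℕ → Carrier) → ∑< (suc n) F ≈ F 0 ∙ ∑< n (F ∘ suc)
  ∑<-head zero    F = ≈-trans (identityˡ (F 0)) (≈-sym (identityʳ (F 0)))
  ∑<-head (suc n) F = ≈-trans (∙-congʳ (∑<-head n F)) (assoc _ _ _)

  ∑<-reverse : ∀ n (F : ℕ → Carrier) → ∑< (suc n) (λ i → F (n ∸ i)) ≈ ∑< (suc n) F
  ∑<-reverse zero    F = ≈-refl
  ∑<-reverse (suc n) F = begin
    ∑< (suc (suc n)) (λ i → F (suc n ∸ i))   ≈⟨ ∑<-head (suc n) _ ⟩
    F (suc n) ∙ ∑< (suc n) (λ i → F (n ∸ i)) ≈⟨ ∙-congˡ (∑<-reverse n F) ⟩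
    F (suc n) ∙ ∑< (suc n) F                 ≈⟨ comm _ _ ⟩
    ∑< (suc (suc n)) F                       ∎

  ∑<-extract : ∀ {n F H a} x → a ℕ.< n → F a ≈ x ∙ H a → (∀ i → i ≢ a → F i ≈ H i) →
               ∑< n F ≈ x ∙ ∑< n H
  ∑<-extract {suc n} {F} {H} {a} x a<1+n Fa≈xHa F≈H with ℕ.m<1+n⇒m<n∨m≡n a<1+n
  ... | inj₁ a<n = begin
    ∑< n F ∙ F n        ≈⟨ ∙-cong (∑<-extract x a<n Fa≈xHa F≈H) (F≈H n (≢-sym (ℕ.<⇒≢ a<n))) ⟩
    (x ∙ ∑< n H) ∙ H n  ≈⟨ assoc x _ _ ⟩
    x ∙ ∑< (suc n) H    ∎
  ... | inj₂ refl = begin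
    ∑< n F ∙ F n        ≈⟨ ∙-cong (∑<-cong n (λ i i<n → F≈H i (ℕ.<⇒≢ i<n))) Fa≈xHa ⟩
    ∑< n H ∙ (x ∙ H n)  ≈⟨ x∙yz≈y∙xz _ x _ ⟩
    x ∙ ∑< (suc n) H    ∎

-- Coefficient sums

sumTo-cong : ∀ m {g h : ℕ → ℤ} → (∀ k → k ≤ m → g k ≡ h k) → sumTo m g ≡ sumTo m h
sumTo-cong zero    eq = eq 0 z≤n
sumTo-cong (suc m) eq =
  cong₂ _+_ (sumTo-cong m (λ k k≤m → eq k (ℕ.m≤n⇒m≤1+n k≤m))) (eq (suc m) ℕ.≤-refl)

sumTo-+ : ∀ m (g h : ℕ → ℤ) → sumTo m (λ k → g k + h k) ≡ sumTo m g + sumTo m h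
sumTo-+ zero    g h = refl
sumTo-+ (suc m) g h = trans (cong (_+ (g (suc m) + h (suc m))) (sumTo-+ m g h))
  (medial (sumTo m g) (sumTo m h) (g (suc m)) (h (suc m)))
  where
  medial : ∀ a b c d → (a + b) + (c + d) ≡ (a + c) + (b + d)
  medial = solve-∀

sumTo-minus : ∀ m (g h : ℕ → ℤ) → sumTo m (λ k → g k - h k) ≡ sumTo m g - sumTo m h
sumTo-minus zero    g h = refl
sumTo-minus (suc m) g h = trans (cong (_+ (g (suc m) - h (suc m))) (sumTo-minus m g h))
  (medial (sumTo m g) (sumTo m h) (g (suc m)) (h (suc m)))
  where
  medial : ∀ a b c d → (a - b) + (c - d) ≡ (a + c) - (b + d)
  medial = solve-∀

sumTo-*ˡ : ∀ m a (g : ℕ → ℤ) → sumTo m (λ k → a * g k) ≡ a * sumTo m g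
sumTo-*ˡ zero    a g = refl
sumTo-*ˡ (suc m) a g =
  trans (cong (_+ a * g (suc m)) (sumTo-*ˡ m a g)) (sym (ℤ.*-distribˡ-+ a (sumTo m g) (g (suc m))))

sumTo-*ʳ : ∀ m a (g : ℕ → ℤ) → sumTo m (λ k → g k * a) ≡ sumTo m g * a
sumTo-*ʳ zero    a g = refl
sumTo-*ʳ (suc m) a g =
  trans (cong (_+ g (suc m) * a) (sumTo-*ʳ m a g)) (sym (ℤ.*-distribʳ-+ a (sumTo m g) (g (suc m))))

sumTo-head : ∀ m (g : ℕ → ℤ) → sumTo (suc m) g ≡ g 0 + sumTo m (g ∘ suc)
sumTo-head zero    g = refl
sumTo-head (suc m) g = trans (cong (_+ g (suc (suc m))) (sumTo-head m g)) (ℤ.+-assoc (g 0) _ _)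

sumTo-reverse : ∀ m (g : ℕ → ℤ) → sumTo m g ≡ sumTo m (λ k → g (m ∸ k))
sumTo-reverse zero    g = refl
sumTo-reverse (suc m) g = begin
  sumTo m g + g (suc m)                  ≡⟨ cong (_+ g (suc m)) (sumTo-reverse m g) ⟩
  sumTo m (λ k → g (m ∸ k)) + g (suc m)  ≡⟨ ℤ.+-comm _ (g (suc m)) ⟩
  g (suc m) + sumTo m (λ k → g (m ∸ k))  ≡⟨ sym (sumTo-head m (λ k → g (suc m ∸ k))) ⟩
  sumTo (suc m) (λ k → g (suc m ∸ k))    ∎
  where open ≡-Reasoning

sumTo-exchange : ∀ m (F : ℕ → ℕ → ℤ) →
  sumTo m (λ k → sumTo k (λ i → F i k)) ≡ sumTo m (λ i → sumTo (m ∸ i) (λ j → F i (i ℕ.+ j)))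
sumTo-exchange zero    F = refl
sumTo-exchange (suc m) F = begin
  sumTo m (λ k → sumTo k (λ i → F i k)) + (sumTo m (λ i → F i (suc m)) + F (suc m) (suc m))
    ≡⟨ cong (_+ (sumTo m (λ i → F i (suc m)) + F (suc m) (suc m))) (sumTo-exchange m F) ⟩
  Rows m + (sumTo m (λ i → F i (suc m)) + F (suc m) (suc m))
    ≡⟨ sym (ℤ.+-assoc (Rows m) _ _) ⟩
  (Rows m + sumTo m (λ i → F i (suc m))) + F (suc m) (suc m)
    ≡⟨ cong₂ _+_ (sym (sumTo-+ m _ _)) (cong (F (suc m)) (sym (ℕ.+-identityʳ (suc m)))) ⟩
  sumTo m (λ i → Row (m ∸ i) i + F i (suc m)) + Row 0 (suc m)
    ≡⟨ cong₂ _+_ (sumTo-cong m extend) (cong (λ d → Row d (suc m)) (sym (ℕ.n∸n≡0 m))) ⟩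
  Rows (suc m) ∎
  where
  open ≡-Reasoning
  Row : ℕ → ℕ → ℤ
  Row d i = sumTo d (λ j → F i (i ℕ.+ j))
  Rows : ℕ → ℤ
  Rows m = sumTo m (λ i → Row (m ∸ i) i)
  extend : ∀ i → i ≤ m → Row (m ∸ i) i + F i (suc m) ≡ Row (suc m ∸ i) i
  extend i i≤m = begin
    Row (m ∸ i) i + F i (suc m)
      ≡⟨ cong (λ k → Row (m ∸ i) i + F i k) (sym (trans (ℕ.+-suc i (m ∸ i)) (cong suc (ℕ.m+[n∸m]≡n i≤m)))) ⟩
    Row (suc (m ∸ i)) i
      ≡⟨ cong (λ d → Row d i) (sym (ℕ.+-∸-assoc 1 i≤m)) ⟩
    Row (suc m ∸ i) i ∎

sumTo-nonneg : ∀ m (h : ℕ → ℤ) → (∀ k → 0ℤ ℤ.≤ h k) → 0ℤ ℤ.≤ sumTo m h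
sumTo-nonneg zero    h h≥0 = h≥0 0
sumTo-nonneg (suc m) h h≥0 = ℤ.+-mono-≤ (sumTo-nonneg m h h≥0) (h≥0 (suc m))

sumTo-pos : ∀ m (h : ℕ → ℤ) → (∀ k → 0ℤ ℤ.≤ h k) → 0ℤ < h m → 0ℤ < sumTo m h
sumTo-pos zero    h h≥0 hₘ>0 = hₘ>0
sumTo-pos (suc m) h h≥0 hₘ>0 = ℤ.+-mono-≤-< (sumTo-nonneg m h h≥0) hₘ>0

mono-resp : ∀ {k m k′ m′} → (m ≡ k → m′ ≡ k′) → (m′ ≡ k′ → m ≡ k) → mono k m ≡ mono k′ m′
mono-resp {k} {m} {k′} {m′} to from with m ℕ.≟ k | m′ ℕ.≟ k′
... | yes _  | yes _   = refl
... | no  _  | no  _   = refl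
... | yes eq | no  neq = ⊥-elim (neq (to eq))
... | no neq | yes eq  = ⊥-elim (neq (from eq))

mono-diag : ∀ k → mono k k ≡ 1ℤ
mono-diag k = mono-resp {k} {k} {0} {0} (λ _ → refl) (λ _ → refl)

mono-off : ∀ {k m} → m ≢ k → mono k m ≡ 0ℤ
mono-off {k} {m} m≢k with m ℕ.≟ k
... | yes m≡k = ⊥-elim (m≢k m≡k)
... | no  _   = refl

mono-shift : ∀ s p {m} → s ≤ m → mono p (m ∸ s) ≡ mono (s ℕ.+ p) m
mono-shift s p s≤m = mono-resp
  (λ eq → trans (sym (ℕ.m+[n∸m]≡n s≤m)) (cong (s ℕ.+_) eq))
  (λ eq → trans (cong (_∸ s) eq) (ℕ.m+n∸m≡n s p))

sumTo-mono-< : ∀ m a (h : ℕ → ℤ) → m ℕ.< a → sumTo m (λ k → mono a k * h k) ≡ 0ℤ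
sumTo-mono-< zero    a h m<a = cong (_* h 0) (mono-off (ℕ.<⇒≢ m<a))
sumTo-mono-< (suc m) a h m<a = cong₂ _+_
  (sumTo-mono-< m a h (ℕ.<-trans (ℕ.n<1+n m) m<a))
  (cong (_* h (suc m)) (mono-off (ℕ.<⇒≢ m<a)))

sumTo-mono-≥ : ∀ m a (h : ℕ → ℤ) → a ≤ m → sumTo m (λ k → mono a k * h k) ≡ h a
sumTo-mono-≥ zero    zero h z≤n = trans (cong (_* h 0) (mono-diag 0)) (ℤ.*-identityˡ (h 0))
sumTo-mono-≥ (suc m) a    h a≤m with ℕ.m≤n⇒m<n∨m≡n a≤m
... | inj₁ a<1+m = begin
  sumTo m (λ k → mono a k * h k) + mono a (suc m) * h (suc m)
    ≡⟨ cong₂ _+_ (sumTo-mono-≥ m a h (ℕ.≤-pred a<1+m))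
                 (cong (_* h (suc m)) (mono-off (≢-sym (ℕ.<⇒≢ a<1+m)))) ⟩
  h a + 0ℤ ≡⟨ ℤ.+-identityʳ (h a) ⟩
  h a      ∎
  where open ≡-Reasoning
... | inj₂ refl = begin
  sumTo m (λ k → mono a k * h k) + mono a a * h a
    ≡⟨ cong₂ _+_ (sumTo-mono-< m a h (ℕ.n<1+n m)) (cong (_* h a) (mono-diag a)) ⟩
  0ℤ + 1ℤ * h a ≡⟨ trans (ℤ.+-identityˡ _) (ℤ.*-identityˡ (h a)) ⟩
  h a           ∎
  where open ≡-Reasoning

-- Power series

infixl 6 _⊞_ _⊟_

_⊞_ : PS → PS → PS
(f ⊞ g) m = f m + g m

_⊟_ : PS → PS → PS
(f ⊟ g) m = f m - g m

1-q^_ : ℕ → PS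
1-q^ a = one ⊟ mono a

infix 4 _≈_

-- A record rather than _≗_, so that f and g can be recovered by unification.
record _≈_ (f g : PS) : Set where
  constructor coeffwise
  field coeff : ∀ m → f m ≡ g m

open _≈_ public

≈-refl : ∀ {f} → f ≈ f
≈-refl .coeff m = refl

≈-sym : ∀ {f g} → f ≈ g → g ≈ f
≈-sym f≈g .coeff m = sym (coeff f≈g m)

≈-trans : ∀ {f g h} → f ≈ g → g ≈ h → f ≈ h
≈-trans f≈g g≈h .coeff m = trans (coeff f≈g m) (coeff g≈h m)

≈-reflexive : ∀ {f g} → f ≡ g → f ≈ g
≈-reflexive refl = ≈-refl

≈-setoid : Setoid 0ℓ 0ℓ
≈-setoid = record
  { Carrier = PS ; _≈_ = _≈_
  ; isEquivalence = record { refl = ≈-refl ; sym = ≈-sym ; trans = ≈-trans } }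

module ≈-Reasoning = Relation.Binary.Reasoning.Setoid ≈-setoid

mono-⊛-≥ : ∀ a g {m} → a ≤ m → (mono a ⊛ g) m ≡ g (m ∸ a)
mono-⊛-≥ a g {m} = sumTo-mono-≥ m a (λ k → g (m ∸ k))

mono-⊛-< : ∀ a g {m} → m ℕ.< a → (mono a ⊛ g) m ≡ 0ℤ
mono-⊛-< a g {m} = sumTo-mono-< m a (λ k → g (m ∸ k))

⊛-cong : ∀ {f f′ g g′} → f ≈ f′ → g ≈ g′ → f ⊛ g ≈ f′ ⊛ g′
⊛-cong f≈f′ g≈g′ .coeff m = sumTo-cong m (λ k _ → cong₂ _*_ (coeff f≈f′ k) (coeff g≈g′ (m ∸ k)))

⊛-congˡ : ∀ f {g g′} → g ≈ g′ → f ⊛ g ≈ f ⊛ g′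
⊛-congˡ f = ⊛-cong (≈-refl {f})

⊛-congʳ : ∀ g {f f′} → f ≈ f′ → f ⊛ g ≈ f′ ⊛ g
⊛-congʳ g f≈f′ = ⊛-cong f≈f′ (≈-refl {g})

⊞-cong : ∀ {f f′ g g′} → f ≈ f′ → g ≈ g′ → f ⊞ g ≈ f′ ⊞ g′
⊞-cong f≈f′ g≈g′ .coeff m = cong₂ _+_ (coeff f≈f′ m) (coeff g≈g′ m)

⊛-comm : ∀ f g → f ⊛ g ≈ g ⊛ f
⊛-comm f g .coeff m = trans (sumTo-reverse m _) (sumTo-cong m λ k k≤m →
  trans (ℤ.*-comm (f (m ∸ k)) _) (cong (λ j → g j * f (m ∸ k)) (ℕ.m∸[m∸n]≡n k≤m)))

⊛-assoc : ∀ f g h → (f ⊛ g) ⊛ h ≈ f ⊛ (g ⊛ h)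
⊛-assoc f g h .coeff m = begin
  sumTo m (λ k → sumTo k (λ i → f i * g (k ∸ i)) * h (m ∸ k))
    ≡⟨ sumTo-cong m (λ k _ → sym (sumTo-*ʳ k (h (m ∸ k)) _)) ⟩
  sumTo m (λ k → sumTo k (λ i → f i * g (k ∸ i) * h (m ∸ k)))
    ≡⟨ sumTo-exchange m (λ i k → f i * g (k ∸ i) * h (m ∸ k)) ⟩
  sumTo m (λ i → sumTo (m ∸ i) (λ j → f i * g (i ℕ.+ j ∸ i) * h (m ∸ (i ℕ.+ j))))
    ≡⟨ sumTo-cong m (λ i _ → trans (sumTo-cong (m ∸ i) (λ j _ → reindex i j)) (sumTo-*ˡ (m ∸ i) (f i) _)) ⟩
  sumTo m (λ i → f i * sumTo (m ∸ i) (λ j → g j * h (m ∸ i ∸ j))) ∎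
  where
  open ≡-Reasoning
  reindex : ∀ i j → f i * g (i ℕ.+ j ∸ i) * h (m ∸ (i ℕ.+ j)) ≡ f i * (g j * h (m ∸ i ∸ j))
  reindex i j = trans (cong₂ (λ u v → f i * g u * h v) (ℕ.m+n∸m≡n i j) (sym (ℕ.∸-+-assoc m i j)))
                      (ℤ.*-assoc (f i) (g j) _)

⊛-identityˡ : ∀ g → one ⊛ g ≈ g
⊛-identityˡ g .coeff m = mono-⊛-≥ 0 g z≤n

⊛-identityʳ : ∀ g → g ⊛ one ≈ g
⊛-identityʳ g = ≈-trans (⊛-comm g one) (⊛-identityˡ g)

⊛-distribʳ-⊞ : ∀ f g h → (f ⊞ g) ⊛ h ≈ f ⊛ h ⊞ g ⊛ h
⊛-distribʳ-⊞ f g h .coeff m =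
  trans (sumTo-cong m (λ k _ → ℤ.*-distribʳ-+ (h (m ∸ k)) (f k) (g k))) (sumTo-+ m _ _)

⊛-distribʳ-⊟ : ∀ f g h → (f ⊟ g) ⊛ h ≈ f ⊛ h ⊟ g ⊛ h
⊛-distribʳ-⊟ f g h .coeff m =
  trans (sumTo-cong m (λ k _ → distrib (f k) (g k) (h (m ∸ k)))) (sumTo-minus m _ _)
  where
  distrib : ∀ a b c → (a - b) * c ≡ a * c - b * c
  distrib = solve-∀

⊛-commutativeMonoid : CommutativeMonoid 0ℓ 0ℓ
⊛-commutativeMonoid = record
  { Carrier             = PS
  ; _≈_                 = _≈_
  ; _∙_                 = _⊛_
  ; ε                   = one
  ; isCommutativeMonoid = record
    { isMonoid = record
      { isSemigroup = record
        { isMagma = record { isEquivalence = Setoid.isEquivalence ≈-setoid ; ∙-cong = ⊛-cong }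
        ; assoc   = ⊛-assoc
        }
      ; identity = ⊛-identityˡ , ⊛-identityʳ
      }
    ; comm = ⊛-comm
    }
  }

open RangeSum ℕ.+-0-commutativeMonoid using (∑<; ∑<-distrib; ∑<-reverse; ∑<-extract)
open RangeSum ⊛-commutativeMonoid
  using () renaming (∑< to ∏<; ∑<-cong to ∏<-cong; ∑<-ε to ∏<-ε; ∑<-distrib to ∏<-distrib;
                     ∑<-head to ∏<-head; ∑<-extract to ∏<-extract)
open CommutativeMonoidSolver ⊛-commutativeMonoid using (solve; _⊕_; _⊜_; id)

_^_ : PS → ℕ → PS
f ^ zero  = one
f ^ suc k = f ⊛ f ^ k

infixr 8 _^_

^-pred : ∀ f {k} → 1 ≤ k → f ^ k ≡ f ⊛ f ^ (k ∸ 1)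
^-pred f {suc k} _ = refl

poch-∏< : ∀ a d n → poch a d n ≈ ∏< n (λ j → 1-q^ (a ℕ.+ d ℕ.* j))
poch-∏< a d zero    = ≈-refl
poch-∏< a d (suc n) = ⊛-congʳ (1-q^ (a ℕ.+ d ℕ.* n)) (poch-∏< a d n)

⊛-quotient : ∀ {f h} g v → f ⊛ g ≈ h → g ⊛ v ≈ one → f ≈ h ⊛ v
⊛-quotient {f} {h} g v fg≈h gv≈one = begin
  f              ≈⟨ ≈-sym (⊛-identityʳ f) ⟩
  f ⊛ one        ≈⟨ ⊛-congˡ f (≈-sym gv≈one) ⟩
  f ⊛ (g ⊛ v)    ≈⟨ ≈-sym (⊛-assoc f g v) ⟩
  (f ⊛ g) ⊛ v    ≈⟨ ⊛-congʳ v fg≈h ⟩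
  h ⊛ v          ∎
  where open ≈-Reasoning

1-q^-+ : ∀ s t → 1-q^ (s ℕ.+ t) ≈ 1-q^ s ⊞ mono s ⊛ 1-q^ t
1-q^-+ s t .coeff m with s ℕ.≤? m
... | yes s≤m = begin
  one m - mono (s ℕ.+ t) m
    ≡⟨ telescope (one m) (mono s m) _ ⟩
  (one m - mono s m) + (mono s m - mono (s ℕ.+ t) m)
    ≡⟨ cong (λ x → (one m - mono s m) + x) (sym shifted) ⟩
  (one m - mono s m) + (mono s ⊛ 1-q^ t) m ∎
  where
  open ≡-Reasoning
  telescope : ∀ a b c → a - c ≡ (a - b) + (b - c)
  telescope = solve-∀
  shifted : (mono s ⊛ 1-q^ t) m ≡ mono s m - mono (s ℕ.+ t) m
  shifted = trans (mono-⊛-≥ s (1-q^ t) s≤m)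
                  (cong₂ _-_ (trans (mono-shift s 0 s≤m) (cong (λ k → mono k m) (ℕ.+-identityʳ s)))
                             (mono-shift s t s≤m))
... | no s≰m = begin
  one m - mono (s ℕ.+ t) m
    ≡⟨ cong (one m -_) (trans (mono-off (ℕ.<⇒≢ (ℕ.<-≤-trans m<s (ℕ.m≤m+n s t))))
                              (sym (mono-off (ℕ.<⇒≢ m<s)))) ⟩
  one m - mono s m
    ≡⟨ sym (ℤ.+-identityʳ _) ⟩
  (one m - mono s m) + 0ℤ
    ≡⟨ cong (λ x → (one m - mono s m) + x) (sym (mono-⊛-< s (1-q^ t) m<s)) ⟩
  (one m - mono s m) + (mono s ⊛ 1-q^ t) m ∎
  where
  open ≡-Reasoning
  m<s = ℕ.≰⇒> s≰m

-- Geometric series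

geom : ℕ → PS
geom s m with s ∣? m
... | yes _ = 1ℤ
... | no  _ = 0ℤ

geom-∣ : ∀ {s m} → s ∣ m → geom s m ≡ 1ℤ
geom-∣ {s} {m} s∣m with s ∣? m
... | yes _   = refl
... | no  s∤m = ⊥-elim (s∤m s∣m)

geom-∤ : ∀ {s m} → ¬ s ∣ m → geom s m ≡ 0ℤ
geom-∤ {s} {m} s∤m with s ∣? m
... | yes s∣m = ⊥-elim (s∤m s∣m)
... | no  _   = refl

geom-shift : ∀ s {m} → s ≤ m → geom s (m ∸ s) ≡ geom s m
geom-shift s {m} s≤m with s ∣? m
... | yes s∣m = geom-∣ (∣m+n∣m⇒∣n (subst (s ∣_) (sym (ℕ.m+[n∸m]≡n s≤m)) s∣m) ∣-refl)
... | no  s∤m = geom-∤ (λ s∣m∸s → s∤m (∣m∸n∣n⇒∣m s s≤m s∣m∸s ∣-refl))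

geom-inverse : ∀ s .{{_ : NonZero s}} → 1-q^ s ⊛ geom s ≈ one
geom-inverse s .coeff m = begin
  ((one ⊟ mono s) ⊛ geom s) m
    ≡⟨ coeff (⊛-distribʳ-⊟ one (mono s) (geom s)) m ⟩
  (one ⊛ geom s) m - (mono s ⊛ geom s) m
    ≡⟨ cong (_- (mono s ⊛ geom s) m) (coeff (⊛-identityˡ (geom s)) m) ⟩
  geom s m - (mono s ⊛ geom s) m
    ≡⟨ telescope (s ℕ.≤? m) ⟩
  one m ∎
  where
  open ≡-Reasoning
  below : ∀ m → m ℕ.< s → geom s m ≡ one m
  below zero    _   = geom-∣ (s ∣0)
  below (suc m) m<s = trans (geom-∤ (>⇒∤ m<s)) (sym (mono-off {0} {suc m} λ ()))
  telescope : Dec (s ≤ m) → geom s m - (mono s ⊛ geom s) m ≡ one m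
  telescope (yes s≤m) = begin
    geom s m - (mono s ⊛ geom s) m
      ≡⟨ cong (geom s m -_) (trans (mono-⊛-≥ s (geom s) s≤m) (geom-shift s s≤m)) ⟩
    geom s m - geom s m
      ≡⟨ ℤ.+-inverseʳ (geom s m) ⟩
    0ℤ
      ≡⟨ sym (mono-off (ℕ.n>0⇒n≢0 (ℕ.<-≤-trans (ℕ.>-nonZero⁻¹ s) s≤m))) ⟩
    one m ∎
  telescope (no s≰m) = begin
    geom s m - (mono s ⊛ geom s) m  ≡⟨ cong (geom s m -_) (mono-⊛-< s (geom s) (ℕ.≰⇒> s≰m)) ⟩
    geom s m - 0ℤ                   ≡⟨ ℤ.+-identityʳ (geom s m) ⟩
    geom s m                        ≡⟨ below m (ℕ.≰⇒> s≰m) ⟩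
    one m                           ∎

geom-partial-fraction : ∀ s t .{{_ : NonZero s}} .{{_ : NonZero t}} →
                        1-q^ (s ℕ.+ t) ⊛ (geom s ⊛ geom t) ≈ geom t ⊞ mono s ⊛ geom s
geom-partial-fraction s t = begin
  1-q^ (s ℕ.+ t) ⊛ (geom s ⊛ geom t)
    ≈⟨ ⊛-congʳ (geom s ⊛ geom t) (1-q^-+ s t) ⟩
  (1-q^ s ⊞ mono s ⊛ 1-q^ t) ⊛ (geom s ⊛ geom t)
    ≈⟨ ⊛-distribʳ-⊞ (1-q^ s) (mono s ⊛ 1-q^ t) (geom s ⊛ geom t) ⟩
  1-q^ s ⊛ (geom s ⊛ geom t) ⊞ (mono s ⊛ 1-q^ t) ⊛ (geom s ⊛ geom t)
    ≈⟨ ⊞-cong (≈-sym (⊛-assoc (1-q^ s) (geom s) (geom t)))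
              (solve 4 (λ x l g h → (x ⊕ l) ⊕ (g ⊕ h) ⊜ x ⊕ ((l ⊕ h) ⊕ g)) ≈-refl
                     (mono s) (1-q^ t) (geom s) (geom t)) ⟩
  (1-q^ s ⊛ geom s) ⊛ geom t ⊞ mono s ⊛ ((1-q^ t ⊛ geom t) ⊛ geom s)
    ≈⟨ ⊞-cong (⊛-congʳ (geom t) (geom-inverse s))
              (⊛-congˡ (mono s) (⊛-congʳ (geom s) (geom-inverse t))) ⟩
  one ⊛ geom t ⊞ mono s ⊛ (one ⊛ geom s)
    ≈⟨ ⊞-cong (⊛-identityˡ (geom t)) (⊛-congˡ (mono s) (⊛-identityˡ (geom s))) ⟩
  geom t ⊞ mono s ⊛ geom s ∎
  where open ≈-Reasoning

-- Nonnegative and positive series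

Nonneg : PS → Set
Nonneg f = ∀ m → 0ℤ ℤ.≤ f m

Positive : PS → Set
Positive f = ∀ m → 0ℤ < f m

Nonneg⁺ : PS → Set
Nonneg⁺ f = Nonneg f × 0ℤ < f 0

0≤i*j : ∀ {i j} → 0ℤ ℤ.≤ i → 0ℤ ℤ.≤ j → 0ℤ ℤ.≤ i * j
0≤i*j {+ m} {+ n} _ _ = subst (0ℤ ℤ.≤_) (ℤ.pos-* m n) (+≤+ z≤n)

0<i*j : ∀ {i j} → 0ℤ < i → 0ℤ < j → 0ℤ < i * j
0<i*j {+ suc m} {+ suc n} _ _         = subst (0ℤ <_) (ℤ.pos-* (suc m) (suc n)) (+<+ (s≤s z≤n))
0<i*j {+ zero}            (+<+ ()) _
0<i*j {+ suc _} {+ zero}  _ (+<+ ())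

Positive-resp : ∀ {f g} → f ≈ g → Positive f → Positive g
Positive-resp f≈g f>0 m = subst (0ℤ <_) (coeff f≈g m) (f>0 m)

Nonneg⁺-resp : ∀ {f g} → f ≈ g → Nonneg⁺ f → Nonneg⁺ g
Nonneg⁺-resp f≈g (f≥0 , f₀>0) =
  (λ m → subst (0ℤ ℤ.≤_) (coeff f≈g m) (f≥0 m)) , subst (0ℤ <_) (coeff f≈g 0) f₀>0

Nonneg-⊛ : ∀ {f g} → Nonneg f → Nonneg g → Nonneg (f ⊛ g)
Nonneg-⊛ f≥0 g≥0 m = sumTo-nonneg m _ (λ k → 0≤i*j (f≥0 k) (g≥0 (m ∸ k)))

Nonneg⁺-⊛ : ∀ {f g} → Nonneg⁺ f → Nonneg⁺ g → Nonneg⁺ (f ⊛ g)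
Nonneg⁺-⊛ (f≥0 , f₀>0) (g≥0 , g₀>0) = Nonneg-⊛ f≥0 g≥0 , 0<i*j f₀>0 g₀>0

-- The last term f m * g 0 of the Cauchy sum is already positive.
Positive-⊛ : ∀ {f g} → Positive f → Nonneg⁺ g → Positive (f ⊛ g)
Positive-⊛ {f} {g} f>0 (g≥0 , g₀>0) m = sumTo-pos m _
  (λ k → 0≤i*j (ℤ.<⇒≤ (f>0 k)) (g≥0 (m ∸ k)))
  (subst (λ j → 0ℤ < f m * g j) (sym (ℕ.n∸n≡0 m)) (0<i*j (f>0 m) g₀>0))

Nonneg⁺-⊞ : ∀ {f g} → Nonneg⁺ f → Nonneg g → Nonneg⁺ (f ⊞ g)
Nonneg⁺-⊞ (f≥0 , f₀>0) g≥0 = (λ m → ℤ.+-mono-≤ (f≥0 m) (g≥0 m)) , ℤ.+-mono-<-≤ f₀>0 (g≥0 0)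

Positive-⊞ : ∀ {f g} → Positive f → Nonneg g → Positive (f ⊞ g)
Positive-⊞ f>0 g≥0 m = ℤ.+-mono-<-≤ (f>0 m) (g≥0 m)

Nonneg-mono : ∀ k → Nonneg (mono k)
Nonneg-mono k m with m ℕ.≟ k
... | yes _ = +≤+ z≤n
... | no  _ = +≤+ z≤n

Nonneg⁺-one : Nonneg⁺ one
Nonneg⁺-one = Nonneg-mono 0 , +<+ (s≤s z≤n)

Nonneg⁺-geom : ∀ s → Nonneg⁺ (geom s)
Nonneg⁺-geom s = geom≥0 , subst (0ℤ <_) (sym (geom-∣ (s ∣0))) (+<+ (s≤s z≤n))
  where
  geom≥0 : Nonneg (geom s)
  geom≥0 m with s ∣? m
  ... | yes _ = +≤+ z≤n
  ... | no  _ = +≤+ z≤n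

Positive-geom-1 : Positive (geom 1)
Positive-geom-1 m = subst (0ℤ <_) (sym (geom-∣ (1∣ m))) (+<+ (s≤s z≤n))

Nonneg⁺-^ : ∀ {f} k → Nonneg⁺ f → Nonneg⁺ (f ^ k)
Nonneg⁺-^ zero    _    = Nonneg⁺-one
Nonneg⁺-^ (suc k) f≥0⁺ = Nonneg⁺-⊛ f≥0⁺ (Nonneg⁺-^ k f≥0⁺)

Nonneg⁺-∏< : ∀ n {F} → (∀ i → Nonneg⁺ (F i)) → Nonneg⁺ (∏< n F)
Nonneg⁺-∏< zero    _   = Nonneg⁺-one
Nonneg⁺-∏< (suc n) F≥0⁺ = Nonneg⁺-⊛ (Nonneg⁺-∏< n F≥0⁺) (F≥0⁺ n)

-- The reduction

odd : ℕ → ℕ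
odd i = suc (2 ℕ.* i)

oddGeom : ℕ → PS
oddGeom i = geom (odd i)

ratio : ℕ → PS
ratio k = 1-q^ (suc (odd k)) ⊛ oddGeom k ^ 2

ratios : ℕ → ℕ → PS
ratios K r = ∏< r (λ j → ratio (K ℕ.+ j))

denominators : (ℕ → ℕ) → ℕ → PS
denominators c K = ∏< K (λ i → oddGeom i ^ c i)

stage : (ℕ → ℕ) → ℕ → ℕ → PS
stage c K r = denominators c K ⊛ ratios K r

decr : (ℕ → ℕ) → ℕ → ℕ → ℕ
decr c a i = c i ∸ (if does (i ℕ.≟ a) then 1 else 0)

decr-at : ∀ c a → decr c a a ≡ c a ∸ 1
decr-at c a = cong (λ b → c a ∸ (if b then 1 else 0)) (dec-true (a ℕ.≟ a) refl)

decr-off : ∀ c {a i} → i ≢ a → decr c a i ≡ c i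
decr-off c {a} {i} i≢a = cong (λ b → c i ∸ (if b then 1 else 0)) (dec-false (i ℕ.≟ a) i≢a)

decr-≤ : ∀ c a i → decr c a i ≤ c i
decr-≤ c a i = ℕ.m∸n≤m (c i) (if does (i ℕ.≟ a) then 1 else 0)

decr-comm : ∀ c a b i → decr (decr c a) b i ≡ decr (decr c b) a i
decr-comm c a b i = ∸-comm (c i) (δ a) (δ b)
  where
  δ : ℕ → ℕ
  δ x = if does (i ℕ.≟ x) then 1 else 0
  ∸-comm : ∀ m n o → m ∸ n ∸ o ≡ m ∸ o ∸ n
  ∸-comm m n o = trans (ℕ.∸-+-assoc m n o) (trans (cong (m ∸_) (ℕ.+-comm n o)) (sym (ℕ.∸-+-assoc m o n)))

∑<-decr : ∀ {n} c a → a ℕ.< n → 1 ≤ c a → ∑< n c ≡ suc (∑< n (decr c a))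
∑<-decr c a a<n 1≤ca = ∑<-extract 1 a<n
  (trans (sym (ℕ.m+[n∸m]≡n 1≤ca)) (cong suc (sym (decr-at c a))))
  (λ i i≢a → sym (decr-off c i≢a))

denominators-decr : ∀ {K} c a → a ℕ.< K → 1 ≤ c a →
                    denominators c K ≈ oddGeom a ⊛ denominators (decr c a) K
denominators-decr c a a<K 1≤ca = ∏<-extract (oddGeom a) a<K
  (≈-reflexive (trans (^-pred (oddGeom a) 1≤ca)
                      (cong (λ k → oddGeom a ⊛ oddGeom a ^ k) (sym (decr-at c a)))))
  (λ i i≢a → ≈-reflexive (cong (oddGeom i ^_) (sym (decr-off c i≢a))))

denominators-cong : ∀ {c c′} K → (∀ i → c i ≡ c′ i) → denominators c K ≈ denominators c′ K
denominators-cong K c≡c′ = ∏<-cong K (λ i _ → ≈-reflexive (cong (oddGeom i ^_) (c≡c′ i)))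

denominators-nonneg : ∀ c K → Nonneg⁺ (denominators c K)
denominators-nonneg c K = Nonneg⁺-∏< K (λ i → Nonneg⁺-^ (c i) (Nonneg⁺-geom (odd i)))

ratios-suc : ∀ K r → ratios K (suc r) ≈ ratio K ⊛ ratios (suc K) r
ratios-suc K r = ≈-trans (∏<-head r _)
  (⊛-cong (≈-reflexive (cong ratio (ℕ.+-identityʳ K)))
          (∏<-cong r (λ j _ → ≈-reflexive (cong ratio (ℕ.+-suc K j)))))

stage-suc : ∀ c K r → c K ≡ 2 → stage c K (suc r) ≈ 1-q^ (suc (odd K)) ⊛ stage c (suc K) r
stage-suc c K r cK≡2 = begin
  D ⊛ ratios K (suc r)
    ≈⟨ ⊛-congˡ D (ratios-suc K r) ⟩
  D ⊛ ((l ⊛ g ^ 2) ⊛ R)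
    ≈⟨ solve 4 (λ D l g² R → D ⊕ ((l ⊕ g²) ⊕ R) ⊜ l ⊕ ((D ⊕ g²) ⊕ R)) ≈-refl D l (g ^ 2) R ⟩
  l ⊛ ((D ⊛ g ^ 2) ⊛ R)
    ≈⟨ ⊛-congˡ l (⊛-congʳ R (⊛-congˡ D (≈-reflexive (cong (g ^_) (sym cK≡2))))) ⟩
  l ⊛ stage c (suc K) r ∎
  where
  open ≈-Reasoning
  D = denominators c K
  l = 1-q^ (suc (odd K))
  g = oddGeom K
  R = ratios (suc K) r

-- The entries from K on are fixed to 2, so that denominators c (suc K) already holds the two
-- denominators of ratio K.
record Admissible (K : ℕ) (c : ℕ → ℕ) : Set where
  field
    bounded   : ∀ i → c i ≤ 2
    saturated : ∀ {i} → K ≤ i → c i ≡ 2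
    total     : ∑< K c ≡ K

∑<-admissible : ∀ {K c} → Admissible K c → ∑< (suc K) c ≡ 2 ℕ.+ K
∑<-admissible {K} adm = trans (cong₂ ℕ._+_ total (saturated ℕ.≤-refl)) (ℕ.+-comm K 2)
  where open Admissible adm

Crowded : (ℕ → ℕ) → ℕ → ℕ → Set
Crowded c a b = 2 ℕ.< c a ℕ.+ c b

crowded-sym : ∀ c a b → Crowded c a b → Crowded c b a
crowded-sym c a b = subst (2 ℕ.<_) (ℕ.+-comm (c a) (c b))

crowded-left : ∀ {c} a b → (∀ i → c i ≤ 2) → Crowded c a b → 1 ≤ c a
crowded-left {c} a b bounded crowded =
  ℕ.+-cancelʳ-< 2 0 (c a) (ℕ.<-≤-trans crowded (ℕ.+-monoʳ-≤ (c a) (bounded b)))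

crowded-decr : ∀ {c} a b → (∀ i → c i ≤ 2) → Crowded c a b → 1 ≤ decr c a b
crowded-decr {c} a b bounded crowded with b ℕ.≟ a
... | yes refl = subst (1 ≤_) (sym (decr-at c b)) (at-least-two (c b) crowded)
  where
  at-least-two : ∀ n → 2 ℕ.< n ℕ.+ n → 1 ≤ n ∸ 1
  at-least-two (suc (suc _)) _ = s≤s z≤n
  at-least-two (suc zero) (s≤s (s≤s ()))
... | no  b≢a  = subst (1 ≤_) (sym (decr-off c b≢a)) (crowded-left b a bounded (crowded-sym c a b crowded))

admissible-decr : ∀ {K c} a → Admissible K c → a ≤ K → 1 ≤ c a → Admissible (suc K) (decr c a)
admissible-decr {K} {c} a adm a≤K 1≤ca = record
  { bounded   = λ i → ℕ.≤-trans (decr-≤ c a i) (bounded i)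
  ; saturated = λ K<i → trans (decr-off c (ℕ.>⇒≢ (ℕ.≤-<-trans a≤K K<i))) (saturated (ℕ.<⇒≤ K<i))
  ; total     = ℕ.suc-injective (trans (sym (∑<-decr c a (s≤s a≤K) 1≤ca)) (∑<-admissible adm))
  }
  where open Admissible adm

admissible-split : ∀ {K c} a b → Admissible K c → a ℕ.+ b ≡ K → Crowded c a b →
                   Admissible (suc K) (decr c a) × Admissible (suc K) (decr c b)
admissible-split {K} {c} a b adm a+b≡K crowded =
  admissible-decr a adm (subst (a ≤_) a+b≡K (ℕ.m≤m+n a b)) (crowded-left a b bounded crowded) ,
  admissible-decr b adm (subst (b ≤_) a+b≡K (ℕ.m≤n+m b a))
                        (crowded-left b a bounded (crowded-sym c a b crowded))
  where open Admissible adm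

∑<-pigeonhole : ∀ n k (g : ℕ → ℕ) → n ℕ.* k ℕ.< ∑< n g → ∃ λ i → i ℕ.< n × k ℕ.< g i
∑<-pigeonhole (suc n) k g nk<∑ with k ℕ.<? g n
... | yes k<gn = n , ℕ.n<1+n n , k<gn
... | no  k≮gn = let i , i<n , k<gi = ∑<-pigeonhole n k g smaller in i , ℕ.m<n⇒m<1+n i<n , k<gi
  where
  smaller : n ℕ.* k ℕ.< ∑< n g
  smaller = ℕ.+-cancelˡ-< k (n ℕ.* k) (∑< n g) (ℕ.<-≤-trans nk<∑
    (ℕ.≤-trans (ℕ.+-monoʳ-≤ (∑< n g) (ℕ.≮⇒≥ k≮gn)) (ℕ.≤-reflexive (ℕ.+-comm (∑< n g) k))))

pair-sums-large : ∀ {K c} → Admissible K c → suc K ℕ.* 2 ℕ.< ∑< (suc K) (λ a → c a ℕ.+ c (K ∸ a))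
pair-sums-large {K} {c} adm = begin-strict
  suc K ℕ.* 2                                     <⟨ ℕ.m<m+n (suc K ℕ.* 2) (s≤s z≤n) ⟩
  suc K ℕ.* 2 ℕ.+ 2                               ≡⟨ count K ⟩
  (2 ℕ.+ K) ℕ.+ (2 ℕ.+ K)                         ≡⟨ sym (cong₂ ℕ._+_ (∑<-admissible adm)
                                                        (trans (∑<-reverse K c) (∑<-admissible adm))) ⟩
  ∑< (suc K) c ℕ.+ ∑< (suc K) (λ a → c (K ∸ a))   ≡⟨ sym (∑<-distrib (suc K) c (λ a → c (K ∸ a))) ⟩
  ∑< (suc K) (λ a → c a ℕ.+ c (K ∸ a))            ∎
  where
  open ℕ.≤-Reasoning
  count : ∀ K → suc K ℕ.* 2 ℕ.+ 2 ≡ (2 ℕ.+ K) ℕ.+ (2 ℕ.+ K)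
  count = ℕ-Solver.solve-∀

split : ∀ {K c} → Admissible K c → ∃₂ λ a b → a ℕ.+ b ≡ K × Crowded c a b × (0 ℕ.< K → 0 ℕ.< a)
split {K} {c} adm with ∑<-pigeonhole (suc K) 2 (λ a → c a ℕ.+ c (K ∸ a)) (pair-sums-large adm)
... | zero  , _     , crowded =
  K , 0 , ℕ.+-identityʳ K , crowded-sym c 0 K crowded , λ K>0 → K>0
... | suc a , a<1+K , crowded =
  suc a , K ∸ suc a , ℕ.m+[n∸m]≡n (ℕ.≤-pred a<1+K) , crowded , λ _ → s≤s z≤n

stage-split : ∀ {K c} r → Admissible K c → ∀ a b → a ℕ.+ b ≡ K → Crowded c a b →
              stage c K (suc r) ≈ stage (decr c a) (suc K) r ⊞ mono (odd a) ⊛ stage (decr c b) (suc K) r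
stage-split {K} {c} r adm a b a+b≡K crowded = begin
  stage c K (suc r)
    ≈⟨ stage-suc c K r (saturated ℕ.≤-refl) ⟩
  1-q^ (suc (odd K)) ⊛ (denominators c (suc K) ⊛ R)
    ≈⟨ ⊛-cong (≈-reflexive (cong 1-q^_ exponent)) (⊛-congʳ R (≈-trans Dc (⊛-congˡ Ga Da))) ⟩
  1-q^ (odd a ℕ.+ odd b) ⊛ ((Ga ⊛ (Gb ⊛ Q)) ⊛ R)
    ≈⟨ solve 5 (λ l x y q r → l ⊕ ((x ⊕ (y ⊕ q)) ⊕ r) ⊜ (l ⊕ (x ⊕ y)) ⊕ (q ⊕ r)) ≈-refl
               (1-q^ (odd a ℕ.+ odd b)) Ga Gb Q R ⟩
  (1-q^ (odd a ℕ.+ odd b) ⊛ (Ga ⊛ Gb)) ⊛ (Q ⊛ R)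
    ≈⟨ ⊛-congʳ (Q ⊛ R) (geom-partial-fraction (odd a) (odd b)) ⟩
  (Gb ⊞ mono (odd a) ⊛ Ga) ⊛ (Q ⊛ R)
    ≈⟨ ⊛-distribʳ-⊞ Gb (mono (odd a) ⊛ Ga) (Q ⊛ R) ⟩
  Gb ⊛ (Q ⊛ R) ⊞ (mono (odd a) ⊛ Ga) ⊛ (Q ⊛ R)
    ≈⟨ ⊞-cong (≈-sym (⊛-assoc Gb Q R))
              (solve 4 (λ x g q r → (x ⊕ g) ⊕ (q ⊕ r) ⊜ x ⊕ ((g ⊕ q) ⊕ r)) ≈-refl (mono (odd a)) Ga Q R) ⟩
  (Gb ⊛ Q) ⊛ R ⊞ mono (odd a) ⊛ ((Ga ⊛ Q) ⊛ R)
    ≈⟨ ⊞-cong (⊛-congʳ R (≈-sym Da)) (⊛-congˡ (mono (odd a)) (⊛-congʳ R (≈-sym Db))) ⟩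
  stage (decr c a) (suc K) r ⊞ mono (odd a) ⊛ stage (decr c b) (suc K) r ∎
  where
  open ≈-Reasoning
  open Admissible adm
  R  = ratios (suc K) r
  Ga = oddGeom a
  Gb = oddGeom b
  Q  = denominators (decr (decr c a) b) (suc K)
  a<1+K : a ℕ.< suc K
  a<1+K = s≤s (subst (a ≤_) a+b≡K (ℕ.m≤m+n a b))
  b<1+K : b ℕ.< suc K
  b<1+K = s≤s (subst (b ≤_) a+b≡K (ℕ.m≤n+m b a))
  Dc : denominators c (suc K) ≈ Ga ⊛ denominators (decr c a) (suc K)
  Dc = denominators-decr c a a<1+K (crowded-left a b bounded crowded)
  Da : denominators (decr c a) (suc K) ≈ Gb ⊛ Q
  Da = denominators-decr (decr c a) b b<1+K (crowded-decr a b bounded crowded)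
  Db : denominators (decr c b) (suc K) ≈ Ga ⊛ Q
  Db = ≈-trans (denominators-decr (decr c b) a a<1+K (crowded-decr b a bounded (crowded-sym c a b crowded)))
               (⊛-congˡ Ga (denominators-cong (suc K) (decr-comm c b a)))
  exponent : suc (odd K) ≡ odd a ℕ.+ odd b
  exponent = subst (λ k → suc (odd k) ≡ odd a ℕ.+ odd b) a+b≡K (odd-sum a b)
    where
    odd-sum : ∀ a b → 2 ℕ.+ 2 ℕ.* (a ℕ.+ b) ≡ (1 ℕ.+ 2 ℕ.* a) ℕ.+ (1 ℕ.+ 2 ℕ.* b)
    odd-sum = ℕ-Solver.solve-∀

stage-nonneg : ∀ r {K c} → Admissible K c → Nonneg⁺ (stage c K r)
stage-nonneg zero    {K} {c} adm = Nonneg⁺-⊛ (denominators-nonneg c K) Nonneg⁺-one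
stage-nonneg (suc r) {K} {c} adm =
  let a , b , a+b≡K , crowded , _ = split adm
      adm-a , adm-b = admissible-split a b adm a+b≡K crowded
  in  Nonneg⁺-resp (≈-sym (stage-split r adm a b a+b≡K crowded))
        (Nonneg⁺-⊞ (stage-nonneg r adm-a) (Nonneg-⊛ (Nonneg-mono (odd a)) (proj₁ (stage-nonneg r adm-b))))

stage-positive : ∀ r {K c} → Admissible K c → 0 ℕ.< K → 1 ≤ c 0 → Positive (stage c K r)
stage-positive zero    {K} {c} adm K>0 1≤c₀ = Positive-⊛ denominators-positive Nonneg⁺-one
  where
  denominators-positive : Positive (denominators c K)
  denominators-positive = Positive-resp (≈-sym (denominators-decr c 0 K>0 1≤c₀))
    (Positive-⊛ Positive-geom-1 (denominators-nonneg (decr c 0) K))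
stage-positive (suc r) {K} {c} adm K>0 1≤c₀ =
  let a , b , a+b≡K , crowded , a>0 = split adm
      adm-a , adm-b = admissible-split a b adm a+b≡K crowded
      0≢a = ℕ.<⇒≢ (a>0 K>0)
  in  Positive-resp (≈-sym (stage-split r adm a b a+b≡K crowded))
        (Positive-⊞ (stage-positive r adm-a (s≤s z≤n) (subst (1 ≤_) (sym (decr-off c 0≢a)) 1≤c₀))
                    (Nonneg-⊛ (Nonneg-mono (odd a)) (proj₁ (stage-nonneg r adm-b))))

stage-positive-initial : ∀ r → Positive (stage (λ _ → 2) 0 (suc r))
stage-positive-initial r =
  Positive-resp (≈-sym (stage-split r adm 0 0 refl crowded))
    (Positive-⊞ (stage-positive r adm′ (s≤s z≤n) (s≤s z≤n))
                (Nonneg-⊛ (Nonneg-mono 1) (proj₁ (stage-nonneg r adm′))))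
  where
  adm : Admissible 0 (λ _ → 2)
  adm = record { bounded = λ _ → ℕ.≤-refl ; saturated = λ _ → refl ; total = refl }
  crowded : Crowded (λ _ → 2) 0 0
  crowded = s≤s (s≤s (s≤s z≤n))
  adm′ : Admissible 1 (decr (λ _ → 2) 0)
  adm′ = proj₁ (admissible-split 0 0 adm refl crowded)

poch-odd²-inverse : ∀ n → (poch 1 2 n ⊛ poch 1 2 n) ⊛ denominators (λ _ → 2) n ≈ one
poch-odd²-inverse n = begin
  (poch 1 2 n ⊛ poch 1 2 n) ⊛ D
    ≈⟨ ⊛-congʳ D (⊛-cong (poch-∏< 1 2 n) (poch-∏< 1 2 n)) ⟩
  (∏< n l ⊛ ∏< n l) ⊛ D
    ≈⟨ ⊛-congʳ D (≈-sym (∏<-distrib n l l)) ⟩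
  ∏< n (λ j → l j ⊛ l j) ⊛ D
    ≈⟨ ≈-sym (∏<-distrib n (λ j → l j ⊛ l j) (λ j → oddGeom j ^ 2)) ⟩
  ∏< n (λ j → (l j ⊛ l j) ⊛ oddGeom j ^ 2)
    ≈⟨ ∏<-ε n (λ j _ → cancel j) ⟩
  one ∎
  where
  open ≈-Reasoning
  l : ℕ → PS
  l j = 1-q^ (odd j)
  D = denominators (λ _ → 2) n
  cancel : ∀ j → (l j ⊛ l j) ⊛ oddGeom j ^ 2 ≈ one
  cancel j = begin
    (l j ⊛ l j) ⊛ (oddGeom j ⊛ (oddGeom j ⊛ one))
      ≈⟨ solve 2 (λ x g → (x ⊕ x) ⊕ (g ⊕ (g ⊕ id)) ⊜ (x ⊕ g) ⊕ (x ⊕ g)) ≈-refl (l j) (oddGeom j) ⟩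
    (l j ⊛ oddGeom j) ⊛ (l j ⊛ oddGeom j)
      ≈⟨ ⊛-cong (geom-inverse (odd j)) (geom-inverse (odd j)) ⟩
    one ⊛ one
      ≈⟨ ⊛-identityˡ one ⟩
    one ∎

quotient≈stage : ∀ n {f} → f ⊛ (poch 1 2 n ⊛ poch 1 2 n) ≈ poch 2 2 n → f ≈ stage (λ _ → 2) 0 n
quotient≈stage n {f} quotient = begin
  f
    ≈⟨ ⊛-quotient (poch 1 2 n ⊛ poch 1 2 n) D quotient (poch-odd²-inverse n) ⟩
  poch 2 2 n ⊛ D
    ≈⟨ ⊛-congʳ D (poch-∏< 2 2 n) ⟩
  ∏< n (λ j → 1-q^ (suc (odd j))) ⊛ D
    ≈⟨ ≈-sym (∏<-distrib n (λ j → 1-q^ (suc (odd j))) (λ j → oddGeom j ^ 2)) ⟩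
  ratios 0 n
    ≈⟨ ≈-sym (⊛-identityˡ (ratios 0 n)) ⟩
  stage (λ _ → 2) 0 n ∎
  where
  open ≈-Reasoning
  D = denominators (λ _ → 2) n

theorem1p3 : (n : ℕ) → 1 ≤ n → (f : PS)
           → (∀ m → (f ⊛ (poch 1 2 n ⊛ poch 1 2 n)) m ≡ poch 2 2 n m)
           → ∀ m → 0ℤ < f m
theorem1p3 (suc r) _ f quotient =
  Positive-resp (≈-sym (quotient≈stage (suc r) (coeffwise quotient))) (stage-positive-initial r)
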